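{- Let $\rho$ be a redex, $e$ an expression and $\mathcal{E}$ an evaluation context. Then $e \rhd (\mathcal{E},\rho)$ holds if and only if $\mathcal{E}[\rho] = e$.
   Context: Fix sets $\mathit{Var}$ (variables), $\mathit{Rid}$ (revision identifiers) and $\mathit{Lid}$ (location identifiers), and a set of constants $\mathit{Const}$ containing $\mathsf{unit}$, $\mathsf{true}$, $\mathsf{false}$. Values and expressions are the mutually inductive syntax trees (not taken modulo $\alpha$-equivalence) $v ::= c \mid x \mid l \mid r \mid \lambda x.e$ (with $c\in\mathit{Const}$, $x\in\mathit{Var}$, $l\in\mathit{Lid}$, $r\in\mathit{Rid}$) and $e ::= v \mid e\ e \mid e\ ?\ e : e \mid \mathsf{ref}\ e \mid !e \mid e := e \mid \mathsf{rfork}\ e \mid \mathsf{rjoin}\ e$. Evaluation contexts are $\mathcal{E} ::= \square \mid \mathcal{E}\ e \mid v\ \mathcal{E} \mid \mathcal{E}\ ?\ e : e \mid \mathsf{ref}\ \mathcal{E} \mid !\mathcal{E} \mid \mathcal{E} := e \mid l := \mathcal{E} \mid \mathsf{rjoin}\ \mathcal{E}$ (with $v$ a value, $l \in \mathit{Lid}$), and $\mathcal{E}[e]$ denotes the expression obtained by replacing the unique hole $\square$ of $\mathcal{E}$ by $e$. A redex is an expression of one of the forms $(\lambda x.e)\ v$, $\mathsf{true}\ ?\ e_1 : e_2$, $\mathsf{false}\ ?\ e_1 : e_2$, $\mathsf{ref}\ v$, $!l$, $l := v$, $\mathsf{rfork}\ e$, $\mathsf{rjoin}\ r$ (with $v$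 a value, $l\in \mathit{Lid}$, $r\in\mathit{Rid}$). The relation $e \rhd (\mathcal{E},\rho)$ is defined inductively by the rules: (1) if $e$ is a redex then $e \rhd (\square, e)$; (2) if $e_1\ e_2$ is not a redex and $e_1 \rhd (\mathcal{E},\rho)$ then $e_1\ e_2 \rhd (\mathcal{E}\ e_2,\rho)$; (3) if $v$ is a value, $v\ e_2$ is not a redex and $e_2 \rhd (\mathcal{E},\rho)$ then $v\ e_2 \rhd (v\ \mathcal{E},\rho)$; (4) if $e_1\ ?\ e_2 : e_3$ is not a redex and $e_1 \rhd(\mathcal{E},\rho)$ then $e_1\ ?\ e_2 : e_3 \rhd (\mathcal{E}\ ?\ e_2 : e_3,\rho)$; (5) if $\mathsf{ref}\ e$ is not a redex and $e\rhd(\mathcal{E},\rho)$ then $\mathsf{ref}\ e \rhd (\mathsf{ref}\ \mathcal{E},\rho)$; (6) if $!e$ is not a redex and $e\rhd(\mathcal{E},\rho)$ then $!e \rhd (!\mathcal{E},\rho)$; (7) if $e_1 := e_2$ is not a redex and $e_1 \rhd(\mathcal{E},\rho)$ then $e_1 := e_2 \rhd (\mathcal{E} := e_2,\rho)$; (8) if $l\in\mathit{Lid}$, $l := e_2$ is not a redex and $e_2\rhd(\mathcal{E},\rho)$ then $l := e_2 \rhd (l := \mathcal{E},\rho)$; (9) if $\mathsf{rjoin}\ e$ is not a redex and $e \rhd(\mathcal{E},\rho)$ then $\mathsf{rjoin}\ e \rhd (\mathsf{rjoin}\ \mathcal{E},\rho)$. -}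

module Defs where

open import Relation.Nullary using (¬_)

module Lang (Var Rid Lid Const : Set) (unit true false : Const) where

  mutual
    data Val : Set where
      cst : Const → Val
      var : Var → Val
      loc : Lid → Val
      rid : Rid → Val
      lam : Var → Exp → Val

    data Exp : Set where
      val   : Val → Exp
      app   : Exp → Exp → Exp
      cond  : Exp → Exp → Exp → Exp
      ref   : Exp → Exp
      deref : Exp → Exp
      assign : Exp → Exp → Exp
      rfork : Exp → Exp
      rjoin : Exp → Exp

  data Ctx : Set where
    hole     : Ctx
    appL     : Ctx → Exp → Ctx
    appR     : Val → Ctx → Ctx
    condC    : Ctx → Exp → Exp → Ctx
    refC     : Ctx → Ctx
    derefC   : Ctx → Ctx
    assignL  : Ctx → Exp → Ctx
    assignR  : Lid → Ctx → Ctx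
    rjoinC   : Ctx → Ctx

  plug : Ctx → Exp → Exp
  plug hole e = e
  plug (appL E e₂) e = app (plug E e) e₂
  plug (appR v E) e = app (val v) (plug E e)
  plug (condC E e₂ e₃) e = cond (plug E e) e₂ e₃
  plug (refC E) e = ref (plug E e)
  plug (derefC E) e = deref (plug E e)
  plug (assignL E e₂) e = assign (plug E e) e₂
  plug (assignR l E) e = assign (val (loc l)) (plug E e)
  plug (rjoinC E) e = rjoin (plug E e)

  data IsRedex : Exp → Set where
    r-beta   : ∀ x e v → IsRedex (app (val (lam x e)) (val v))
    r-true   : ∀ e₁ e₂ → IsRedex (cond (val (cst true)) e₁ e₂)
    r-false  : ∀ e₁ e₂ → IsRedex (cond (val (cst false)) e₁ e₂)
    r-ref    : ∀ v → IsRedex (ref (val v))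
    r-deref  : ∀ l → IsRedex (deref (val (loc l)))
    r-assign : ∀ l v → IsRedex (assign (val (loc l)) (val v))
    r-rfork  : ∀ e → IsRedex (rfork e)
    r-rjoin  : ∀ r → IsRedex (rjoin (val (rid r)))

  data _▷_,_ : Exp → Ctx → Exp → Set where
    d-redex  : ∀ {e} → IsRedex e → e ▷ hole , e
    d-appL   : ∀ {e₁ e₂ E ρ} → ¬ IsRedex (app e₁ e₂) → e₁ ▷ E , ρ →
               app e₁ e₂ ▷ appL E e₂ , ρ
    d-appR   : ∀ {v e₂ E ρ} → ¬ IsRedex (app (val v) e₂) → e₂ ▷ E , ρ →
               app (val v) e₂ ▷ appR v E , ρ
    d-cond   : ∀ {e₁ e₂ e₃ E ρ} → ¬ IsRedex (cond e₁ e₂ e₃) → e₁ ▷ E , ρ →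
               cond e₁ e₂ e₃ ▷ condC E e₂ e₃ , ρ
    d-ref    : ∀ {e E ρ} → ¬ IsRedex (ref e) → e ▷ E , ρ → ref e ▷ refC E , ρ
    d-deref  : ∀ {e E ρ} → ¬ IsRedex (deref e) → e ▷ E , ρ → deref e ▷ derefC E , ρ
    d-assignL : ∀ {e₁ e₂ E ρ} → ¬ IsRedex (assign e₁ e₂) → e₁ ▷ E , ρ →
               assign e₁ e₂ ▷ assignL E e₂ , ρ
    d-assignR : ∀ {l e₂ E ρ} → ¬ IsRedex (assign (val (loc l)) e₂) → e₂ ▷ E , ρ →
               assign (val (loc l)) e₂ ▷ assignR l E , ρ
    d-rjoin  : ∀ {e E ρ} → ¬ IsRedex (rjoin e) → e ▷ E , ρ → rjoin e ▷ rjoinC E , ρ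

-- For completeness,
-- induct on E: every side condition "is not a redex" holds because a redex
-- never is a value, hence neither is any E[ρ], whereas each redex form has a
-- value exactly in the position where a context frame puts its hole.
module Submission where

open import Defs
open import Data.Product using (_×_; _,_)
open import Relation.Binary.PropositionalEquality using (_≡_; refl; cong)
open import Relation.Nullary using (¬_)

module Decomposition (Var Rid Lid Const : Set) (unit true false : Const) where
  open Lang Var Rid Lid Const unit true false

  data IsValue : Exp → Set where
    value : ∀ v → IsValue (val v)

  redex⇒¬value : ∀ {e} → IsRedex e → ¬ IsValue e
  redex⇒¬value () (value _)

  plug-¬value : ∀ {e} → ¬ IsValue e → (E : Ctx) → ¬ IsValue (plug E e)
  plug-¬value ¬v hole          = ¬v
  plug-¬value _  (appL _ _)    ()
  plug-¬value _  (appR _ _)    ()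
  plug-¬value _  (condC _ _ _) ()
  plug-¬value _  (refC _)      ()
  plug-¬value _  (derefC _)    ()
  plug-¬value _  (assignL _ _) ()
  plug-¬value _  (assignR _ _) ()
  plug-¬value _  (rjoinC _)    ()

  plug-redex-¬value : ∀ {ρ} → IsRedex ρ → (E : Ctx) → ¬ IsValue (plug E ρ)
  plug-redex-¬value r = plug-¬value (redex⇒¬value r)

  app-¬redexˡ : ∀ {e₁ e₂} → ¬ IsValue e₁ → ¬ IsRedex (app e₁ e₂)
  app-¬redexˡ ¬v (r-beta _ _ _) = ¬v (value _)

  app-¬redexʳ : ∀ {v e₂} → ¬ IsValue e₂ → ¬ IsRedex (app (val v) e₂)
  app-¬redexʳ ¬v (r-beta _ _ _) = ¬v (value _)

  cond-¬redex : ∀ {e₁ e₂ e₃} → ¬ IsValue e₁ → ¬ IsRedex (cond e₁ e₂ e₃)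
  cond-¬redex ¬v (r-true _ _)  = ¬v (value _)
  cond-¬redex ¬v (r-false _ _) = ¬v (value _)

  ref-¬redex : ∀ {e} → ¬ IsValue e → ¬ IsRedex (ref e)
  ref-¬redex ¬v (r-ref _) = ¬v (value _)

  deref-¬redex : ∀ {e} → ¬ IsValue e → ¬ IsRedex (deref e)
  deref-¬redex ¬v (r-deref _) = ¬v (value _)

  assign-¬redexˡ : ∀ {e₁ e₂} → ¬ IsValue e₁ → ¬ IsRedex (assign e₁ e₂)
  assign-¬redexˡ ¬v (r-assign _ _) = ¬v (value _)

  assign-¬redexʳ : ∀ {l e₂} → ¬ IsValue e₂ → ¬ IsRedex (assign (val (loc l)) e₂)
  assign-¬redexʳ ¬v (r-assign _ _) = ¬v (value _)

  rjoin-¬redex : ∀ {e} → ¬ IsValue e → ¬ IsRedex (rjoin e)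
  rjoin-¬redex ¬v (r-rjoin _) = ¬v (value _)

  ▷⇒plug≡ : ∀ {e E ρ} → e ▷ E , ρ → plug E ρ ≡ e
  ▷⇒plug≡ (d-redex _)     = refl
  ▷⇒plug≡ (d-appL _ d)    = cong (λ x → app x _) (▷⇒plug≡ d)
  ▷⇒plug≡ (d-appR _ d)    = cong (app _) (▷⇒plug≡ d)
  ▷⇒plug≡ (d-cond _ d)    = cong (λ x → cond x _ _) (▷⇒plug≡ d)
  ▷⇒plug≡ (d-ref _ d)     = cong ref (▷⇒plug≡ d)
  ▷⇒plug≡ (d-deref _ d)   = cong deref (▷⇒plug≡ d)
  ▷⇒plug≡ (d-assignL _ d) = cong (λ x → assign x _) (▷⇒plug≡ d)
  ▷⇒plug≡ (d-assignR _ d) = cong (assign _) (▷⇒plug≡ d)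
  ▷⇒plug≡ (d-rjoin _ d)   = cong rjoin (▷⇒plug≡ d)

  plug-▷ : ∀ {ρ} → IsRedex ρ → (E : Ctx) → plug E ρ ▷ E , ρ
  plug-▷ r hole            = d-redex r
  plug-▷ r (appL E _)      = d-appL    (app-¬redexˡ    (plug-redex-¬value r E)) (plug-▷ r E)
  plug-▷ r (appR _ E)      = d-appR    (app-¬redexʳ    (plug-redex-¬value r E)) (plug-▷ r E)
  plug-▷ r (condC E _ _)   = d-cond    (cond-¬redex    (plug-redex-¬value r E)) (plug-▷ r E)
  plug-▷ r (refC E)        = d-ref     (ref-¬redex     (plug-redex-¬value r E)) (plug-▷ r E)
  plug-▷ r (derefC E)      = d-deref   (deref-¬redex   (plug-redex-¬value r E)) (plug-▷ r E)
  plug-▷ r (assignL E _)   = d-assignL (assign-¬redexˡ (plug-redex-¬value r E)) (plug-▷ r E)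
  plug-▷ r (assignR _ E)   = d-assignR (assign-¬redexʳ (plug-redex-¬value r E)) (plug-▷ r E)
  plug-▷ r (rjoinC E)      = d-rjoin   (rjoin-¬redex   (plug-redex-¬value r E)) (plug-▷ r E)

lemma3p1 : (Var Rid Lid Const : Set) (unit true false : Const) →
    let open Lang Var Rid Lid Const unit true false in
    (ρ e : Exp) (E : Ctx) → IsRedex ρ →
      ((e ▷ E , ρ → plug E ρ ≡ e) × (plug E ρ ≡ e → e ▷ E , ρ))
lemma3p1 Var Rid Lid Const unit true false ρ e E r = ▷⇒plug≡ , λ { refl → plug-▷ r E }
  where open Decomposition Var Rid Lid Const unit true false
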